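{- For all $s\in\mathit{Act}^*$ and $g\in\mathit{Act}^*\cup\mathit{Act}^\omega$: (i) if $\psi\in\mathrm{ftmuS}$ and $sg\in[\![\psi]\!]_F$, then $s\in[\![\psi]\!]_F$; (ii) if $\psi\in\mathrm{ftmuC}$ and $s\in[\![\psi]\!]_F$, then $sg\in[\![\psi]\!]_F$.
   Context: Fix a finite set $\mathit{Act}$ of actions. recHML formulas: $\psi::=\mathrm{tt}\mid\mathrm{ff}\mid\psi\vee\psi\mid\psi\wedge\psi\mid\langle A\rangle\psi\mid[A]\psi\mid\min X.\psi\mid\max X.\psi\mid X$ with $A\subseteq\mathit{Act}$; formulas are closed and guarded (each bound variable occurrence lies within a modality inside its binder). Fragments: $\mathrm{ftmuS}$: $\psi::=\mathrm{tt}\mid\mathrm{ff}\mid[A]\psi\mid\psi\vee\psi\mid\psi\wedge\psi\mid\max X.\psi\mid X$; $\mathrm{ftmuC}$: $\psi::=\mathrm{tt}\mid\mathrm{ff}\mid\langle A\rangle\psi\mid\psi\vee\psi\mid\psi\wedge\psi\mid\min X.\psi\mid X$. Finfinite semantics over $\mathit{FTrc}=\mathit{Act}^*\cup\mathit{Act}^\omega$, with valuations $\sigma$: $[\![\mathrm{tt}]\!]_F=\mathit{FTrc}$, $[\![\mathrm{ff}]\!]_F=\emptyset$, $\vee,\wedge$ union/intersection, $[\![\langle A\rangle\psi]\!]_F=\{ag\mid a\in A,g\in[\![\psi]\!]_F\}$, $[\![[A]\psi]\!]_F=\{g\mid\forall a\in A,\forall g'.\ g=ag'\Rightarrow g'\in[\![\psi]\!]_F\}$,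 $[\![\min X.\psi,\sigma]\!]_F=\bigcap\{S\mid[\![\psi,\sigma[X\mapsto S]]\!]_F\subseteq S\}$, $[\![\max X.\psi,\sigma]\!]_F=\bigcup\{S\mid S\subseteq[\![\psi,\sigma[X\mapsto S]]\!]_F\}$, $[\![X,\sigma]\!]_F=\sigma(X)$. -}

module Defs where

open import Data.Nat using (ℕ; zero; suc)
open import Data.Fin using (Fin; zero; suc)
open import Data.Fin.Subset using (Subset; _∈_)
open import Data.List using (List; []; _∷_; _++_)
open import Data.Bool using (Bool; true; false)
open import Data.Maybe using (Maybe; just; nothing)
open import Data.Product using (Σ; _×_; ∃; _,_)
open import Data.Sum using (_⊎_)
open import Data.Unit using (⊤)
open import Data.Empty using (⊥)
open import Relation.Binary.PropositionalEquality using (_≡_)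

-- The finite action set Act is Fin k (k arbitrary).

data FTrc (k : ℕ) : Set where
  fin : List (Fin k) → FTrc k
  inf : (ℕ → Fin k) → FTrc k

prepend : ∀ {k} → List (Fin k) → (ℕ → Fin k) → ℕ → Fin k
prepend []      f n       = f n
prepend (a ∷ l) f zero    = a
prepend (a ∷ l) f (suc n) = prepend l f n

_·_ : ∀ {k} → FTrc k → FTrc k → FTrc k
fin l · fin m = fin (l ++ m)
fin l · inf f = inf (prepend l f)
inf f · g     = inf f

hd : ∀ {k} → FTrc k → Maybe (Fin k)
hd (fin [])      = nothing
hd (fin (a ∷ l)) = just a
hd (inf f)       = just (f zero)

tl : ∀ {k} → FTrc k → FTrc k
tl (fin [])      = fin []
tl (fin (a ∷ l)) = fin l
tl (inf f)       = inf (λ n → f (suc n))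

-- recHML formulas, de Bruijn style: Formula k n has n bound variables in scope

data Formula (k : ℕ) (n : ℕ) : Set where
  tt ff : Formula k n
  _∨̂_ _∧̂_ : Formula k n → Formula k n → Formula k n
  ⟨_⟩_ : Subset k → Formula k n → Formula k n
  [_]_ : Subset k → Formula k n → Formula k n
  minX maxX : Formula k (suc n) → Formula k n
  var : Fin n → Formula k n

-- Guardedness: every variable occurrence lies under a modality inside its binder.
-- u i = true means variable i is currently unguarded (no modality since its binder).
extendU : ∀ {n} → (Fin n → Bool) → Fin (suc n) → Bool
extendU u zero    = true
extendU u (suc i) = u i

GuardedU : ∀ {k n} → (Fin n → Bool) → Formula k n → Set
GuardedU u tt        = ⊤
GuardedU u ff        = ⊤
GuardedU u (φ ∨̂ ψ)   = GuardedU u φ × GuardedU u ψ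
GuardedU u (φ ∧̂ ψ)   = GuardedU u φ × GuardedU u ψ
GuardedU u (⟨ A ⟩ ψ) = GuardedU (λ _ → false) ψ
GuardedU u ([ A ] ψ) = GuardedU (λ _ → false) ψ
GuardedU u (minX ψ)  = GuardedU (extendU u) ψ
GuardedU u (maxX ψ)  = GuardedU (extendU u) ψ
GuardedU u (var i)   = u i ≡ false

Guarded : ∀ {k} → Formula k 0 → Set
Guarded ψ = GuardedU (λ ()) ψ

InS : ∀ {k n} → Formula k n → Set
InS tt        = ⊤
InS ff        = ⊤
InS (φ ∨̂ ψ)   = InS φ × InS ψ
InS (φ ∧̂ ψ)   = InS φ × InS ψ
InS (⟨ A ⟩ ψ) = ⊥
InS ([ A ] ψ) = InS ψ
InS (minX ψ)  = ⊥
InS (maxX ψ)  = InS ψ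
InS (var i)   = ⊤

InC : ∀ {k n} → Formula k n → Set
InC tt        = ⊤
InC ff        = ⊤
InC (φ ∨̂ ψ)   = InC φ × InC ψ
InC (φ ∧̂ ψ)   = InC φ × InC ψ
InC (⟨ A ⟩ ψ) = InC ψ
InC ([ A ] ψ) = ⊥
InC (minX ψ)  = InC ψ
InC (maxX ψ)  = ⊥
InC (var i)   = ⊤

-- Finfinite semantics.  Subsets of FTrc (the elements of the powerset over
-- which the fixpoints range, and the values of valuations) are
-- characteristic functions FTrc k → Bool.

TSet : ℕ → Set
TSet k = FTrc k → Bool

Val : ℕ → ℕ → Set
Val k n = Fin n → TSet k

extendV : ∀ {k n} → TSet k → Val k n → Val k (suc n)
extendV S σ zero    = S
extendV S σ (suc i) = σ i

⟦_⟧ : ∀ {k n} → Formula k n → Val k n → FTrc k → Set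
⟦ tt ⟧      σ g = ⊤
⟦ ff ⟧      σ g = ⊥
⟦ φ ∨̂ ψ ⟧   σ g = ⟦ φ ⟧ σ g ⊎ ⟦ ψ ⟧ σ g
⟦ φ ∧̂ ψ ⟧   σ g = ⟦ φ ⟧ σ g × ⟦ ψ ⟧ σ g
⟦ ⟨ A ⟩ ψ ⟧ σ g = Σ (Fin _) λ a → a ∈ A × hd g ≡ just a × ⟦ ψ ⟧ σ (tl g)
⟦ [ A ] ψ ⟧ σ g = ∀ a → a ∈ A → hd g ≡ just a → ⟦ ψ ⟧ σ (tl g)
⟦ minX ψ ⟧  σ g = (S : TSet _) → (∀ h → ⟦ ψ ⟧ (extendV S σ) h → S h ≡ true) → S g ≡ true
⟦ maxX ψ ⟧  σ g = Σ (TSet _) λ S → (∀ h → S h ≡ true → ⟦ ψ ⟧ (extendV S σ) h) × S g ≡ true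
⟦ var i ⟧   σ g = σ i g ≡ true

σ∅ : ∀ {k} → Val k 0
σ∅ ()

{-# OPTIONS --safe #-}
-- Induction on formulas, generalised to open formulas under two valuations σ, σ′
-- related by σ′ X (fin l) = σ X (fin l · g) on finite traces.  At a fixpoint
-- binder the witness set S is transported to its "g-quotient" {l | l · g ∈ S},
-- completed on infinite traces by ∅ for a post-fixpoint (ftmuS) and by all of
-- them for a pre-fixpoint (ftmuC); fixpoints are read off the Knaster–Tarski
-- definitions directly.
module Submission where

open import Defs
open import Data.Nat using (ℕ)
open import Data.Fin using (Fin; zero; suc)
open import Data.List using (List; []; _∷_)
open import Data.Product using (_×_; _,_)
open import Data.Sum using (inj₁; inj₂)
open import Data.Bool using (Bool; true; false)
open import Data.Maybe using (just)
open import Relation.Binary.PropositionalEquality using (_≡_; refl; sym; trans; subst)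

hd-∷-· : ∀ {k} (a : Fin k) l g → hd (fin (a ∷ l) · g) ≡ just a
hd-∷-· a l (fin _) = refl
hd-∷-· a l (inf _) = refl

tl-∷-· : ∀ {k} (a : Fin k) l g → tl (fin (a ∷ l) · g) ≡ fin l · g
tl-∷-· a l (fin _) = refl
tl-∷-· a l (inf _) = refl

_⁄_∣inf↦_ : ∀ {k} → TSet k → FTrc k → Bool → TSet k
(S ⁄ g ∣inf↦ b) (fin l) = S (fin l · g)
(S ⁄ g ∣inf↦ b) (inf _) = b

record _≈[·_]_ {k n} (σ′ : Val k n) (g : FTrc k) (σ : Val k n) : Set where
  field
    lookup : ∀ i l → σ′ i (fin l) ≡ σ i (fin l · g)
open _≈[·_]_

σ∅-≈ : ∀ {k} (g : FTrc k) → σ∅ ≈[· g ] σ∅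
σ∅-≈ g .lookup ()

extendV-≈ : ∀ {k n} {σ′ σ : Val k n} {g} (S : TSet k) b →
  σ′ ≈[· g ] σ → extendV (S ⁄ g ∣inf↦ b) σ′ ≈[· g ] extendV S σ
extendV-≈ S b r .lookup zero    l = refl
extendV-≈ S b r .lookup (suc i) l = r .lookup i l

InS-prefix-closed : ∀ {k n} {σ′ σ : Val k n} {g} (ψ : Formula k n) → InS ψ →
  σ′ ≈[· g ] σ → ∀ l → ⟦ ψ ⟧ σ (fin l · g) → ⟦ ψ ⟧ σ′ (fin l)
InS-prefix-closed tt _ r l h = h
InS-prefix-closed ff _ r l h = h
InS-prefix-closed (φ ∨̂ ψ) (p , q) r l (inj₁ h) = inj₁ (InS-prefix-closed φ p r l h)
InS-prefix-closed (φ ∨̂ ψ) (p , q) r l (inj₂ h) = inj₂ (InS-prefix-closed ψ q r l h)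
InS-prefix-closed (φ ∧̂ ψ) (p , q) r l (h₁ , h₂) =
  InS-prefix-closed φ p r l h₁ , InS-prefix-closed ψ q r l h₂
InS-prefix-closed ([ A ] ψ) p r [] h a a∈A ()
InS-prefix-closed {σ = σ} {g} ([ A ] ψ) p r (b ∷ l) h a a∈A hd≡a =
  InS-prefix-closed ψ p r l
    (subst (⟦ ψ ⟧ σ) (tl-∷-· b l g) (h a a∈A (trans (hd-∷-· b l g) hd≡a)))
InS-prefix-closed {σ′ = σ′} {σ} {g} (maxX ψ) p r l (S , S⊆ψ , l·g∈S) =
  S ⁄ g ∣inf↦ false , S/g⊆ψ , l·g∈S
  where
  S/g⊆ψ : ∀ h → (S ⁄ g ∣inf↦ false) h ≡ true →
          ⟦ ψ ⟧ (extendV (S ⁄ g ∣inf↦ false) σ′) h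
  S/g⊆ψ (fin m) m·g∈S =
    InS-prefix-closed ψ p (extendV-≈ S false r) m (S⊆ψ _ m·g∈S)
  S/g⊆ψ (inf _) ()
InS-prefix-closed (var i) _ r l h = trans (r .lookup i l) h

InC-extension-closed : ∀ {k n} {σ′ σ : Val k n} {g} (ψ : Formula k n) → InC ψ →
  σ′ ≈[· g ] σ → ∀ l → ⟦ ψ ⟧ σ′ (fin l) → ⟦ ψ ⟧ σ (fin l · g)
InC-extension-closed tt _ r l h = h
InC-extension-closed ff _ r l h = h
InC-extension-closed (φ ∨̂ ψ) (p , q) r l (inj₁ h) =
  inj₁ (InC-extension-closed φ p r l h)
InC-extension-closed (φ ∨̂ ψ) (p , q) r l (inj₂ h) =
  inj₂ (InC-extension-closed ψ q r l h)
InC-extension-closed (φ ∧̂ ψ) (p , q) r l (h₁ , h₂) =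
  InC-extension-closed φ p r l h₁ , InC-extension-closed ψ q r l h₂
InC-extension-closed (⟨ A ⟩ ψ) p r [] (a , a∈A , () , h)
InC-extension-closed {σ = σ} {g} (⟨ A ⟩ ψ) p r (b ∷ l) (a , a∈A , hd≡a , h) =
  a , a∈A , trans (hd-∷-· b l g) hd≡a ,
  subst (⟦ ψ ⟧ σ) (sym (tl-∷-· b l g)) (InC-extension-closed ψ p r l h)
InC-extension-closed {σ′ = σ′} {σ} {g} (minX ψ) p r l l∈μ S ψ⊆S =
  l∈μ (S ⁄ g ∣inf↦ true) ψ⊆S/g
  where
  ψ⊆S/g : ∀ h → ⟦ ψ ⟧ (extendV (S ⁄ g ∣inf↦ true) σ′) h →
          (S ⁄ g ∣inf↦ true) h ≡ true
  ψ⊆S/g (fin m) h = ψ⊆S _ (InC-extension-closed ψ p (extendV-≈ S true r) m h)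
  ψ⊆S/g (inf _) _ = refl
InC-extension-closed (var i) _ r l h = trans (sym (r .lookup i l)) h

mainTheorem8 : ∀ {k : ℕ} (s : List (Fin k)) (g : FTrc k) →
    ((ψ : Formula k 0) → Guarded ψ → InS ψ → ⟦ ψ ⟧ σ∅ (fin s · g) → ⟦ ψ ⟧ σ∅ (fin s))
    × ((ψ : Formula k 0) → Guarded ψ → InC ψ → ⟦ ψ ⟧ σ∅ (fin s) → ⟦ ψ ⟧ σ∅ (fin s · g))
mainTheorem8 s g =
  (λ ψ _ ψ∈S → InS-prefix-closed ψ ψ∈S (σ∅-≈ g) s) ,
  (λ ψ _ ψ∈C → InC-extension-closed ψ ψ∈C (σ∅-≈ g) s)
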